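{- Let $n\ge5$ be odd, $T=\langle n,3n-2,3n-1\rangle$, $\mathrm F(T)=\max(\mathbb Z\setminus T)$ and $S=T\cup\{\mathrm F(T)\}$. Let $F=F_1\cup F_2\cup F_3\cup F_4\subseteq\mathbb N^3$ where $F_1=\{(x,y,0): x\le\frac{3n-3}{2},\ y\le\frac{n-3}{2}\}$, $F_2=\{(x,y,0): x\le1,\ y=\frac{n-1}{2}\}$, $F_3=\{(x,y,1): x\le\frac{3n-3}{2},\ y\le\frac{n-7}{2}\}$, $F_4=\{(x,y,1): x\le\frac{3n-5}{2},\ y=\frac{n-5}{2}\}$. Then the normal form map $\mathrm{nf}:\mathrm{Ap}(S,\mathrm F(T))\to F$ is a bijection.
   Context: For $m\in S\setminus\{0\}$, $\mathrm{Ap}(S,m)=\{s\in S: s-m\notin S\}$. For $s\in\mathrm{Ap}(S,\mathrm F(T))$, its normal form $\mathrm{nf}(s)$ is the unique $(x,y,z)\in\mathbb N^3$ with $xn+y(3n-2)+z(3n-1)=s$, $z<2$, $y<\frac{n+1}{2}$, $x<\frac{3n-1}{2}$ (such a triple exists and is unique). -}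

module Defs where

open import Data.Nat using (ℕ; _+_; _*_; _∸_; _≤_; _<_)
open import Data.Product using (Σ; _×_; ∃-syntax)
open import Data.Sum using (_⊎_)
open import Relation.Nullary using (¬_)
open import Relation.Binary.PropositionalEquality using (_≡_)

-- value of a triple: x n + y (3n-2) + z (3n-1)  (n ≥ 1 so 3n-2, 3n-1 are honest)
val : ℕ → ℕ → ℕ → ℕ → ℕ
val n x y z = x * n + y * (3 * n ∸ 2) + z * (3 * n ∸ 1)

InT : ℕ → ℕ → Set
InT n s = ∃[ x ] ∃[ y ] ∃[ z ] val n x y z ≡ s

IsFrobeniusT : ℕ → ℕ → Set
IsFrobeniusT n f = ¬ InT n f × (∀ m → f < m → InT n m)

InS : ℕ → ℕ → ℕ → Set
InS n f s = InT n s ⊎ s ≡ f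

-- s ∈ Ap(S, f): s ∈ S and s - f ∉ S (negative integers are never in S)
InAp : ℕ → ℕ → ℕ → Set
InAp n f s = InS n f s × ¬ (∃[ k ] (k + f ≡ s × InS n f k))

IsNF : ℕ → ℕ → ℕ → ℕ → ℕ → Set
IsNF n s x y z = val n x y z ≡ s × z < 2 × 2 * y < n + 1 × 2 * x + 1 < 3 * n

InF : ℕ → ℕ → ℕ → ℕ → Set
InF n x y z =
    (z ≡ 0 × 2 * x + 3 ≤ 3 * n × 2 * y + 3 ≤ n)
  ⊎ (z ≡ 0 × x ≤ 1 × 2 * y + 1 ≡ n)
  ⊎ (z ≡ 1 × 2 * x + 3 ≤ 3 * n × 2 * y + 7 ≤ n)
  ⊎ (z ≡ 1 × 2 * x + 5 ≤ 3 * n × 2 * y + 5 ≡ n)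

-- Write n = 5 + 2p. Every s ∈ ℕ is s = m n − (2y + z) with z ≤ 1 and 2y + z < n, and
-- s ∈ T iff m ≥ 3(y + z): a generator 3n − 2 or 3n − 1 lowers the residue by at most 2 at the
-- cost of three multiples of n. So the elements of T are exactly the normal forms
-- (m − 3(y + z), y, z), and the largest gap, with y + z = p + 2 and m = 3(y + z) − 1, is
-- F(T) = (3p + 5) n − (2p + 3) = (4 + 3p) n + 2. Subtracting F(T) shifts the residue 2y + z
-- by 2 (modulo n), which decides s − F(T) ∈ S on normal forms: it holds iff x ≥ 3p + 7, or
-- (y, z) = (p + 1, 1), or (y, z) = (p + 2, 0) with x ≥ 2, or s = 2 F(T). The remaining normal
-- forms are exactly F.

module Submission where

open import Defs
open import Data.Nat
open import Data.Nat.Properties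
open import Data.Nat.DivMod using (_/_; _%_; m≡m%n+[m/n]*n; m%n<n)
open import Data.Nat.Divisibility using (_∣_; divides)
open import Data.Nat.Tactic.RingSolver using (solve-∀)
open import Data.Product using (_×_; _,_; proj₁; proj₂; ∃-syntax)
open import Data.Sum using (_⊎_; inj₁; inj₂)
open import Data.Empty using (⊥-elim)
open import Relation.Nullary using (¬_; yes; no)
open import Relation.Binary.Definitions using (tri<; tri≈; tri>)
open import Relation.Binary.PropositionalEquality
open import Function using (case_of_)

halve : ∀ t → ∃[ y ] ∃[ z ] (z ≤ 1 × t ≡ 2 * y + z)
halve t = t / 2 , t % 2 , ≤-pred (m%n<n t 2) , (begin
  t                     ≡⟨ m≡m%n+[m/n]*n t 2 ⟩
  t % 2 + t / 2 * 2     ≡⟨ +-comm (t % 2) _ ⟩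
  t / 2 * 2 + t % 2     ≡⟨ cong (_+ t % 2) (*-comm (t / 2) 2) ⟩
  2 * (t / 2) + t % 2   ∎)
  where open ≡-Reasoning

halve-unique : ∀ {y z y′ z′} → z ≤ 1 → z′ ≤ 1 → 2 * y + z ≡ 2 * y′ + z′ → y ≡ y′ × z ≡ z′
halve-unique {y} {_} {y′} z≤n z≤n e =
  *-cancelˡ-≡ y y′ 2 (trans (sym (+-identityʳ _)) (trans e (+-identityʳ _))) , refl
halve-unique {y} {_} {y′} z≤n (s≤s z≤n) e =
  ⊥-elim (even≢odd y y′ (trans (sym (+-identityʳ _)) (trans e (+-comm _ 1))))
halve-unique {y} {_} {y′} (s≤s z≤n) z≤n e =
  ⊥-elim (even≢odd y′ y (trans (sym (+-identityʳ _)) (trans (sym e) (+-comm _ 1))))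
halve-unique {y} {_} {y′} (s≤s z≤n) (s≤s z≤n) e =
  *-cancelˡ-≡ y y′ 2 (+-cancelʳ-≡ 1 _ _ e) , refl

ceil-half : ∀ {a b z} → z ≤ 1 → 2 * a + z ≤ 2 * b → a + z ≤ b
ceil-half {a} {b} z≤n h =
  subst (_≤ b) (sym (+-identityʳ a)) (*-cancelˡ-≤ 2 (subst (_≤ 2 * b) (+-identityʳ (2 * a)) h))
ceil-half {a} {b} (s≤s z≤n) h =
  subst (_≤ b) (+-comm 1 a) (*-cancelˡ-< 2 a b (subst (_≤ 2 * b) (+-comm (2 * a) 1) h))

split-multiple : ∀ {n} .{{_ : NonZero n}} a c b → a + c * n ≡ b * n → ∃[ m ] (a ≡ m * n × m + c ≡ b)
split-multiple {n} a c b e with m≤n⇒∃[o]m+o≡n (*-cancelʳ-≤ c b n (≤-trans (m≤n+m (c * n) a) (≤-reflexive e)))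
... | m , refl =
  m , +-cancelʳ-≡ (c * n) a (m * n) (trans e (trans (*-distribʳ-+ n c m) (+-comm (c * n) (m * n)))) , +-comm m c

+-<-≤ : ∀ a {b c n} → b < c → a + c ≤ n → a + b < n
+-<-≤ a b<c a+c≤n = <-≤-trans (+-monoʳ-< a b<c) a+c≤n

double-≤ : ∀ {a b} c {d} → a ≤ b → 2 * b + c ≡ d → 2 * a + c ≤ d
double-≤ c a≤b e = ≤-trans (+-monoˡ-≤ c (*-monoʳ-≤ 2 a≤b)) (≤-reflexive e)

undouble-≤ : ∀ {a b} c {d} → 2 * a + c ≤ d → 2 * b + c ≡ d → a ≤ b
undouble-≤ {a} {b} c h e = *-cancelˡ-≤ 2 (+-cancelʳ-≤ c (2 * a) (2 * b) (≤-trans h (≤-reflexive (sym e))))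

undouble-≡ : ∀ {a b} c {d} → 2 * a + c ≡ d → 2 * b + c ≡ d → a ≡ b
undouble-≡ {a} {b} c e e′ = *-cancelˡ-≡ a b 2 (+-cancelʳ-≡ c (2 * a) (2 * b) (trans e (sym e′)))

-- Residues modulo n

record Residue (n s y z m : ℕ) : Set where
  constructor residue
  field
    z≤1 : z ≤ 1
    t<n : 2 * y + z < n
    eq  : s + (2 * y + z) ≡ m * n

round-up-exists : ∀ {n} .{{_ : NonZero n}} s → ∃[ t ] ∃[ m ] (t < n × s + t ≡ m * n)
round-up-exists {suc n} zero = 0 , 0 , z<s , refl
round-up-exists {suc n} (suc s) with round-up-exists {suc n} s
... | suc t , m , t<n , e = t , m , <-trans (n<1+n t) t<n , trans (sym (+-suc s t)) e
... | zero  , m , _   , e = n , suc m , ≤-refl , (begin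
  suc s + n           ≡⟨ cong (λ u → suc u + n) (trans (sym (+-identityʳ s)) e) ⟩
  suc (m * suc n) + n ≡⟨ l m n ⟩
  suc m * suc n       ∎)
  where
  open ≡-Reasoning
  l : ∀ m n → suc (m * suc n) + n ≡ suc m * suc n
  l = solve-∀

quotient-mono : ∀ {n s t t′ m m′} → t < n → s + t ≡ m * n → s + t′ ≡ m′ * n → m ≤ m′
quotient-mono {n} {s} {t} {t′} {m} {m′} t<n e e′ with m ≤? m′
... | yes m≤m′ = m≤m′
... | no m≰m′ = ⊥-elim (<⇒≱ t<n (+-cancelˡ-≤ s n t (begin
  s + n             ≤⟨ +-monoˡ-≤ n (m≤m+n s t′) ⟩
  s + t′ + n        ≡⟨ cong (_+ n) e′ ⟩
  m′ * n + n        ≡⟨ +-comm (m′ * n) n ⟩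
  suc m′ * n        ≤⟨ *-monoˡ-≤ n (≰⇒> m≰m′) ⟩
  m * n             ≡⟨ sym e ⟩
  s + t             ∎)))
  where open ≤-Reasoning

round-up-unique : ∀ {n s t t′ m m′} → t < n → t′ < n → s + t ≡ m * n → s + t′ ≡ m′ * n →
                 t ≡ t′ × m ≡ m′
round-up-unique {n} {s} {m = m} {m′ = m′} t<n t′<n e e′ =
  +-cancelˡ-≡ s _ _ (trans e (trans (cong (_* n) m≡m′) (sym e′))) , m≡m′
  where
  m≡m′ : m ≡ m′
  m≡m′ = ≤-antisym (quotient-mono t<n e e′) (quotient-mono t′<n e′ e)

residue-exists : ∀ {n} .{{_ : NonZero n}} s → ∃[ y ] ∃[ z ] ∃[ m ] Residue n s y z m
residue-exists s with round-up-exists s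
... | t , m , t<n , e with halve t
... | y , z , z≤1 , refl = y , z , m , residue z≤1 t<n e

residue-unique : ∀ {n s y z m y′ z′ m′} → Residue n s y z m → Residue n s y′ z′ m′ →
                 y ≡ y′ × z ≡ z′ × m ≡ m′
residue-unique {s = s} (residue z≤1 t<n e) (residue z′≤1 t′<n e′) =
  let (t≡t′ , m≡m′) = round-up-unique {s = s} t<n t′<n e e′
      (y≡y′ , z≡z′) = halve-unique z≤1 z′≤1 t≡t′
  in y≡y′ , z≡z′ , m≡m′

val+residue : ∀ {n} .{{_ : NonZero n}} x y z → val n x y z + (2 * y + z) ≡ (3 * (y + z) + x) * n
val+residue {n} x y z = begin
  x * n + y * (3 * n ∸ 2) + z * (3 * n ∸ 1) + (2 * y + z)  ≡⟨ l₁ x y z n (3 * n ∸ 2) (3 * n ∸ 1) ⟩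
  x * n + y * (3 * n ∸ 2 + 2) + z * (3 * n ∸ 1 + 1)        ≡⟨ cong₂ (λ a b → x * n + y * a + z * b)
                                                                   (m∸n+n≡m 2≤3n) (m∸n+n≡m 1≤3n) ⟩
  x * n + y * (3 * n) + z * (3 * n)                         ≡⟨ l₂ x y z n ⟩
  (3 * (y + z) + x) * n                                     ∎
  where
  open ≡-Reasoning
  3≤3n : 3 ≤ 3 * n
  3≤3n = *-monoʳ-≤ 3 (>-nonZero⁻¹ n)
  2≤3n : 2 ≤ 3 * n
  2≤3n = ≤-trans (n≤1+n 2) 3≤3n
  1≤3n : 1 ≤ 3 * n
  1≤3n = ≤-trans (n≤1+n 1) 2≤3n
  l₁ : ∀ x y z n a b → x * n + y * a + z * b + (2 * y + z) ≡ x * n + y * (a + 2) + z * (b + 1)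
  l₁ = solve-∀
  l₂ : ∀ x y z n → x * n + y * (3 * n) + z * (3 * n) ≡ (3 * (y + z) + x) * n
  l₂ = solve-∀

residue⇒val : ∀ {n s} .{{_ : NonZero n}} x y z → s + (2 * y + z) ≡ (3 * (y + z) + x) * n →
              val n x y z ≡ s
residue⇒val x y z e = +-cancelʳ-≡ (2 * y + z) _ _ (trans (val+residue x y z) (sym e))

-- Membership in T

-- A representation of s with y′ + z′ generators 3n − 2, 3n − 1 has residue 2y′ + z′ = 2y + z + j n,
-- and its quotient m + j is at least 3(y′ + z′) ≥ 3(y + z + j).
InT⇒3[y+z]≤m : ∀ {n s y z m} → 2 ≤ n → Residue n s y z m → InT n s → 3 * (y + z) ≤ m
InT⇒3[y+z]≤m {n} {s} {y} {z} {m} 2≤n (residue z≤1 t<n e) (x′ , y′ , z′ , refl) =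
  +-cancelʳ-≤ j _ _ (begin
    3 * (y + z) + j       ≤⟨ +-monoʳ-≤ (3 * (y + z)) (m≤n*m j 3) ⟩
    3 * (y + z) + 3 * j   ≡⟨ l₁ y z j ⟩
    3 * (y + j + z)       ≤⟨ *-monoʳ-≤ 3 (ceil-half {y + j} {y′ + z′} z≤1 2[y+j]+z≤2[y′+z′]) ⟩
    3 * (y′ + z′)         ≤⟨ m≤m+n _ x′ ⟩
    3 * (y′ + z′) + x′    ≡⟨ sym m+j≡M ⟩
    m + j                 ∎)
  where
  open ≤-Reasoning
  l₁ : ∀ y z j → 3 * (y + z) + 3 * j ≡ 3 * (y + j + z)
  l₁ = solve-∀
  l₂ : ∀ y j z → 2 * (y + j) + z ≡ 2 * y + z + j * 2
  l₂ = solve-∀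
  instance
    n≢0 : NonZero n
    n≢0 = >-nonZero (≤-trans (s≤s z≤n) 2≤n)
  e′ : val n x′ y′ z′ + (2 * y′ + z′) ≡ (3 * (y′ + z′) + x′) * n
  e′ = val+residue x′ y′ z′
  m≤M : m ≤ 3 * (y′ + z′) + x′
  m≤M = quotient-mono {s = val n x′ y′ z′} t<n e e′
  j : ℕ
  j = proj₁ (m≤n⇒∃[o]m+o≡n m≤M)
  m+j≡M : m + j ≡ 3 * (y′ + z′) + x′
  m+j≡M = proj₂ (m≤n⇒∃[o]m+o≡n m≤M)
  t′≡t+jn : 2 * y′ + z′ ≡ 2 * y + z + j * n
  t′≡t+jn = +-cancelˡ-≡ s _ _ (begin-equality
    s + (2 * y′ + z′)        ≡⟨ e′ ⟩
    (3 * (y′ + z′) + x′) * n ≡⟨ cong (_* n) (sym m+j≡M) ⟩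
    (m + j) * n              ≡⟨ *-distribʳ-+ n m j ⟩
    m * n + j * n            ≡⟨ cong (_+ j * n) (sym e) ⟩
    s + (2 * y + z) + j * n  ≡⟨ +-assoc s _ _ ⟩
    s + (2 * y + z + j * n)  ∎)
  2[y+j]+z≤2[y′+z′] : 2 * (y + j) + z ≤ 2 * (y′ + z′)
  2[y+j]+z≤2[y′+z′] = begin
    2 * (y + j) + z          ≡⟨ l₂ y j z ⟩
    2 * y + z + j * 2        ≤⟨ +-monoʳ-≤ (2 * y + z) (*-monoʳ-≤ j 2≤n) ⟩
    2 * y + z + j * n        ≡⟨ sym t′≡t+jn ⟩
    2 * y′ + z′              ≤⟨ +-monoʳ-≤ (2 * y′) (m≤n*m z′ 2) ⟩
    2 * y′ + 2 * z′          ≡⟨ sym (*-distribˡ-+ 2 y′ z′) ⟩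
    2 * (y′ + z′)            ∎

3[y+z]≤m⇒InT : ∀ {n s y z m} .{{_ : NonZero n}} → Residue n s y z m → 3 * (y + z) ≤ m → InT n s
3[y+z]≤m⇒InT {y = y} {z} (residue _ _ e) h with m≤n⇒∃[o]m+o≡n h
... | x , refl = x , y , z , residue⇒val x y z e

-- The Frobenius number of T for n = 5 + 2p

odd-form : ∀ n → 5 ≤ n → ¬ (2 ∣ n) → ∃[ p ] n ≡ 5 + 2 * p
odd-form n 5≤n n-odd with halve n
... | y , 0 , _ , refl = ⊥-elim (n-odd (divides y (trans (+-identityʳ (2 * y)) (*-comm 2 y))))
... | 0 , 1 , _ , refl = ⊥-elim (≤⇒≯ 5≤n (s≤s (s≤s z≤n)))
... | 1 , 1 , _ , refl = ⊥-elim (≤⇒≯ 5≤n (s≤s (s≤s (s≤s (s≤s z≤n)))))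
... | suc (suc p) , 1 , _ , refl = p , l p
  where
  l : ∀ p → 2 * suc (suc p) + 1 ≡ 5 + 2 * p
  l = solve-∀
... | _ , suc (suc _) , s≤s () , _

frob : ℕ → ℕ
frob p = 2 + (4 + 3 * p) * (5 + 2 * p)

residue-bound : ∀ p {y z} → z ≤ 1 → 2 * y + z < 5 + 2 * p → y + z ≤ 2 + p
residue-bound p z≤1 t<n = ceil-half z≤1 (≤-trans (≤-pred t<n) (≤-reflexive (l p)))
  where
  l : ∀ p → 4 + 2 * p ≡ 2 * (2 + p)
  l = solve-∀

frob-residue : ∀ p → Residue (5 + 2 * p) (frob p) (1 + p) 1 (5 + 3 * p)
frob-residue p = residue (s≤s z≤n) (≤-trans (≤-reflexive (l₁ p)) (n≤1+n _)) (l₂ p)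
  where
  l₁ : ∀ p → suc (2 * (1 + p) + 1) ≡ 4 + 2 * p
  l₁ = solve-∀
  l₂ : ∀ p → 2 + (4 + 3 * p) * (5 + 2 * p) + (2 * (1 + p) + 1) ≡ (5 + 3 * p) * (5 + 2 * p)
  l₂ = solve-∀

frob∉T : ∀ p → ¬ InT (5 + 2 * p) (frob p)
frob∉T p f∈T = <⇒≱ (≤-reflexive (l p)) (InT⇒3[y+z]≤m (s≤s (s≤s z≤n)) (frob-residue p) f∈T)
  where
  l : ∀ p → suc (5 + 3 * p) ≡ 3 * (1 + p + 1)
  l = solve-∀

gap≤frob : ∀ p s → ¬ InT (5 + 2 * p) s → s ≤ frob p
gap≤frob p s s∉T with residue-exists {5 + 2 * p} s
... | y , z , m , r@(residue z≤1 t<n e) with 3 * (y + z) ≤? m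
...   | yes 3w≤m = ⊥-elim (s∉T (3[y+z]≤m⇒InT r 3w≤m))
...   | no 3w≰m with m≤n⇒∃[o]m+o≡n (residue-bound p {y} {z} z≤1 t<n)
...     | d , w+d≡ = +-cancelʳ-≤ (2 * (2 + p) + n) s (frob p) (begin
  s + (2 * (2 + p) + n)            ≡⟨ cong (λ u → s + (2 * u + n)) (sym w+d≡) ⟩
  s + (2 * (y + z + d) + n)        ≡⟨ l₁ s y z d n ⟩
  s + (2 * y + z) + n + z + 2 * d  ≡⟨ cong (λ u → u + n + z + 2 * d) e ⟩
  m * n + n + z + 2 * d            ≡⟨ l₂ m n z d ⟩
  suc m * n + z + 2 * d            ≤⟨ +-mono-≤ (+-mono-≤ (*-monoˡ-≤ n (≰⇒> 3w≰m)) z≤1) 2d≤3dn ⟩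
  3 * (y + z) * n + 1 + 3 * d * n  ≡⟨ l₃ y z d n ⟩
  3 * (y + z + d) * n + 1          ≡⟨ cong (λ u → 3 * u * n + 1) w+d≡ ⟩
  3 * (2 + p) * n + 1              ≡⟨ l₄ p ⟩
  frob p + (2 * (2 + p) + n)       ∎)
  where
  open ≤-Reasoning
  n : ℕ
  n = 5 + 2 * p
  2d≤3dn : 2 * d ≤ 3 * d * n
  2d≤3dn = ≤-trans (*-monoˡ-≤ d (n≤1+n 2)) (m≤m*n (3 * d) n)
  l₁ : ∀ s y z d n → s + (2 * (y + z + d) + n) ≡ s + (2 * y + z) + n + z + 2 * d
  l₁ = solve-∀
  l₂ : ∀ m n z d → m * n + n + z + 2 * d ≡ suc m * n + z + 2 * d
  l₂ = solve-∀
  l₃ : ∀ y z d n → 3 * (y + z) * n + 1 + 3 * d * n ≡ 3 * (y + z + d) * n + 1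
  l₃ = solve-∀
  l₄ : ∀ p → 3 * (2 + p) * (5 + 2 * p) + 1 ≡ 2 + (4 + 3 * p) * (5 + 2 * p) + (2 * (2 + p) + (5 + 2 * p))
  l₄ = solve-∀

frobenius≡frob : ∀ p f → IsFrobeniusT (5 + 2 * p) f → f ≡ frob p
frobenius≡frob p f (f∉T , >f⇒T) with <-cmp f (frob p)
... | tri< f<F _ _ = ⊥-elim (frob∉T p (>f⇒T (frob p) f<F))
... | tri≈ _ f≡F _ = f≡F
... | tri> _ _ F<f = ⊥-elim (<⇒≱ F<f (gap≤frob p f f∉T))

-- The Apéry set of S with respect to F(T)

InS-frob⇒ : ∀ p {k y z m} → Residue (5 + 2 * p) k y z m → InS (5 + 2 * p) (frob p) k →
            3 * (y + z) ≤ m ⊎ (y ≡ 1 + p × z ≡ 1 × m ≡ 5 + 3 * p)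
InS-frob⇒ p r (inj₁ k∈T) = inj₁ (InT⇒3[y+z]≤m (s≤s (s≤s z≤n)) r k∈T)
InS-frob⇒ p r (inj₂ refl) = inj₂ (residue-unique r (frob-residue p))

DiffInS : ℕ → ℕ → ℕ → Set
DiffInS n f s = ∃[ k ] (k + f ≡ s × InS n f k)

-- 3n ∸ 2 and 3n ∸ 1 written out (l is stated on the normal form of val), so that identities
-- between values become ring identities
val-odd : ∀ p x y z → val (5 + 2 * p) x y z ≡ x * (5 + 2 * p) + y * (13 + 6 * p) + z * (14 + 6 * p)
val-odd p x y z = l p x y z
  where
  l : ∀ p x y z → x * (5 + 2 * p) + y * (3 + (2 * p + (5 + 2 * p + (5 + 2 * p + 0))))
                    + z * (4 + (2 * p + (5 + 2 * p + (5 + 2 * p + 0))))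
                  ≡ x * (5 + 2 * p) + y * (13 + 6 * p) + z * (14 + 6 * p)
  l = solve-∀

val+frob≡val : ∀ p x y z x′ y′ z′ →
  x * (5 + 2 * p) + y * (13 + 6 * p) + z * (14 + 6 * p) + frob p
    ≡ x′ * (5 + 2 * p) + y′ * (13 + 6 * p) + z′ * (14 + 6 * p) →
  val (5 + 2 * p) x y z + frob p ≡ val (5 + 2 * p) x′ y′ z′
val+frob≡val p x y z x′ y′ z′ e =
  trans (cong (_+ frob p) (val-odd p x y z)) (trans e (sym (val-odd p x′ y′ z′)))

DiffInS-large-x : ∀ p e y z → DiffInS (5 + 2 * p) (frob p) (val (5 + 2 * p) (7 + 3 * p + e) y z)
DiffInS-large-x p e y z =
  val (5 + 2 * p) e (1 + y) z , val+frob≡val p e (1 + y) z (7 + 3 * p + e) y z (l p e y z) , inj₁ (e , 1 + y , z , refl)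
  where
  l : ∀ p e y z → e * (5 + 2 * p) + (1 + y) * (13 + 6 * p) + z * (14 + 6 * p) + (2 + (4 + 3 * p) * (5 + 2 * p))
                  ≡ (7 + 3 * p + e) * (5 + 2 * p) + y * (13 + 6 * p) + z * (14 + 6 * p)
  l = solve-∀

DiffInS-residue-n∸2 : ∀ p x → DiffInS (5 + 2 * p) (frob p) (val (5 + 2 * p) x (1 + p) 1)
DiffInS-residue-n∸2 p x =
  val (5 + 2 * p) (1 + x) 0 0 , val+frob≡val p (1 + x) 0 0 x (1 + p) 1 (l p x) , inj₁ (1 + x , 0 , 0 , refl)
  where
  l : ∀ p x → (1 + x) * (5 + 2 * p) + 0 * (13 + 6 * p) + 0 * (14 + 6 * p) + (2 + (4 + 3 * p) * (5 + 2 * p))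
              ≡ x * (5 + 2 * p) + (1 + p) * (13 + 6 * p) + 1 * (14 + 6 * p)
  l = solve-∀

DiffInS-residue-n∸1 : ∀ p e → DiffInS (5 + 2 * p) (frob p) (val (5 + 2 * p) (2 + e) (2 + p) 0)
DiffInS-residue-n∸1 p e =
  val (5 + 2 * p) e 0 1 , val+frob≡val p e 0 1 (2 + e) (2 + p) 0 (l p e) , inj₁ (e , 0 , 1 , refl)
  where
  l : ∀ p e → e * (5 + 2 * p) + 0 * (13 + 6 * p) + 1 * (14 + 6 * p) + (2 + (4 + 3 * p) * (5 + 2 * p))
              ≡ (2 + e) * (5 + 2 * p) + (2 + p) * (13 + 6 * p) + 0 * (14 + 6 * p)
  l = solve-∀

DiffInS-2f : ∀ p → DiffInS (5 + 2 * p) (frob p) (val (5 + 2 * p) (6 + 3 * p) p 1)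
DiffInS-2f p = frob p , trans (l p) (sym (val-odd p (6 + 3 * p) p 1)) , inj₂ refl
  where
  l : ∀ p → 2 + (4 + 3 * p) * (5 + 2 * p) + (2 + (4 + 3 * p) * (5 + 2 * p))
            ≡ (6 + 3 * p) * (5 + 2 * p) + p * (13 + 6 * p) + 1 * (14 + 6 * p)
  l = solve-∀

-- Since frob p = (4 + 3p) n + 2, subtracting it raises the residue 2y + z by 2; the residue n − 1
-- wraps around to 1.
difference-residue : ∀ p {k} x y z → k + frob p ≡ val (5 + 2 * p) x y z →
  ∃[ m ] (k + (2 * (1 + y) + z) ≡ m * (5 + 2 * p) × m + (4 + 3 * p) ≡ 3 * (y + z) + x)
difference-residue p {k} x y z k+f≡s = split-multiple _ (4 + 3 * p) _ (begin
  k + (2 * (1 + y) + z) + (4 + 3 * p) * (5 + 2 * p)  ≡⟨ l k y z p ⟩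
  k + frob p + (2 * y + z)                           ≡⟨ cong (_+ (2 * y + z)) k+f≡s ⟩
  val (5 + 2 * p) x y z + (2 * y + z)                ≡⟨ val+residue x y z ⟩
  (3 * (y + z) + x) * (5 + 2 * p)                    ∎)
  where
  open ≡-Reasoning
  l : ∀ k y z p → k + (2 * (1 + y) + z) + (4 + 3 * p) * (5 + 2 * p)
                  ≡ k + (2 + (4 + 3 * p) * (5 + 2 * p)) + (2 * y + z)
  l = solve-∀

difference-residue-top : ∀ p {k} x → k + frob p ≡ val (5 + 2 * p) x (2 + p) 0 →
  ∃[ m ] (k + (2 * 0 + 1) ≡ m * (5 + 2 * p) × m + (5 + 3 * p) ≡ 3 * (2 + p + 0) + x)
difference-residue-top p {k} x k+f≡s = split-multiple _ (5 + 3 * p) _ (begin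
  k + (2 * 0 + 1) + (5 + 3 * p) * (5 + 2 * p)  ≡⟨ l k p ⟩
  k + frob p + (2 * (2 + p) + 0)               ≡⟨ cong (_+ (2 * (2 + p) + 0)) k+f≡s ⟩
  val (5 + 2 * p) x (2 + p) 0 + (2 * (2 + p) + 0) ≡⟨ val+residue x (2 + p) 0 ⟩
  (3 * (2 + p + 0) + x) * (5 + 2 * p)          ∎)
  where
  open ≡-Reasoning
  l : ∀ k p → k + (2 * 0 + 1) + (5 + 3 * p) * (5 + 2 * p)
              ≡ k + (2 + (4 + 3 * p) * (5 + 2 * p)) + (2 * (2 + p) + 0)
  l = solve-∀

difference-quotient⇒large-x : ∀ p {x y z m} → m + (4 + 3 * p) ≡ 3 * (y + z) + x →
                              3 * (1 + y + z) ≤ m → 7 + 3 * p ≤ x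
difference-quotient⇒large-x p {x} {y} {z} {m} m+c≡ 3w≤m = +-cancelˡ-≤ (3 * (y + z)) (7 + 3 * p) x (begin
  3 * (y + z) + (7 + 3 * p)      ≡⟨ l y z p ⟩
  3 * (1 + y + z) + (4 + 3 * p)  ≤⟨ +-monoˡ-≤ (4 + 3 * p) 3w≤m ⟩
  m + (4 + 3 * p)                ≡⟨ m+c≡ ⟩
  3 * (y + z) + x                ∎)
  where
  open ≤-Reasoning
  l : ∀ y z p → 3 * (y + z) + (7 + 3 * p) ≡ 3 * (1 + y + z) + (4 + 3 * p)
  l = solve-∀

difference-quotient⇒2f : ∀ p {x y z m} → m + (4 + 3 * p) ≡ 3 * (y + z) + x →
                          y ≡ p → z ≡ 1 → m ≡ 5 + 3 * p → x ≡ 6 + 3 * p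
difference-quotient⇒2f p {x} m+c≡ refl refl refl = +-cancelˡ-≡ (3 * (p + 1)) x (6 + 3 * p) (trans (sym m+c≡) (l p))
  where
  l : ∀ p → 5 + 3 * p + (4 + 3 * p) ≡ 3 * (p + 1) + (6 + 3 * p)
  l = solve-∀

difference-quotient-top⇒2≤x : ∀ p {x m} → m + (5 + 3 * p) ≡ 3 * (2 + p + 0) + x → 3 * (0 + 1) ≤ m → 2 ≤ x
difference-quotient-top⇒2≤x p {x} {m} m+c≡ 3≤m = +-cancelˡ-≤ (3 * (2 + p + 0)) 2 x (begin
  3 * (2 + p + 0) + 2        ≡⟨ l p ⟩
  3 * (0 + 1) + (5 + 3 * p)  ≤⟨ +-monoˡ-≤ (5 + 3 * p) 3≤m ⟩
  m + (5 + 3 * p)            ≡⟨ m+c≡ ⟩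
  3 * (2 + p + 0) + x        ∎)
  where
  open ≤-Reasoning
  l : ∀ p → 3 * (2 + p + 0) + 2 ≡ 3 * (0 + 1) + (5 + 3 * p)
  l = solve-∀

¬DiffInS-below : ∀ p {x y z} → z ≤ 1 → 2 * (1 + y) + z < 5 + 2 * p → x ≤ 6 + 3 * p →
  ¬ (y ≡ p × z ≡ 1 × x ≡ 6 + 3 * p) → ¬ DiffInS (5 + 2 * p) (frob p) (val (5 + 2 * p) x y z)
¬DiffInS-below p {x} {y} {z} z≤1 t<n x≤ not-2f (k , k+f≡s , k∈S) =
  let (m , e , m+c≡) = difference-residue p x y z k+f≡s in
  case InS-frob⇒ p (residue z≤1 t<n e) k∈S of λ where
    (inj₁ 3w≤m) → ≤⇒≯ x≤ (difference-quotient⇒large-x p {x} {y} {z} m+c≡ 3w≤m)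
    (inj₂ (1+y≡1+p , z≡1 , m≡)) →
      let y≡p = suc-injective 1+y≡1+p in not-2f (y≡p , z≡1 , difference-quotient⇒2f p m+c≡ y≡p z≡1 m≡)

¬DiffInS-top : ∀ p {x} → x ≤ 1 → ¬ DiffInS (5 + 2 * p) (frob p) (val (5 + 2 * p) x (2 + p) 0)
¬DiffInS-top p {x} x≤1 (k , k+f≡s , k∈S) =
  let (m , e , m+c≡) = difference-residue-top p x k+f≡s in
  case InS-frob⇒ p (residue (s≤s z≤n) (s≤s (s≤s z≤n)) e) k∈S of λ where
    (inj₁ 3≤m) → ≤⇒≯ x≤1 (difference-quotient-top⇒2≤x p m+c≡ 3≤m)
    (inj₂ (0≡1+p , _ , _)) → 0≢1+n 0≡1+p

2[1+p]+3≡n : ∀ p → 2 * (1 + p) + 3 ≡ 5 + 2 * p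
2[1+p]+3≡n = solve-∀

2[2+p]+1≡n : ∀ p → 2 * (2 + p) + 1 ≡ 5 + 2 * p
2[2+p]+1≡n = solve-∀

2[6+3p]+3≡3n : ∀ p → 2 * (6 + 3 * p) + 3 ≡ 3 * (5 + 2 * p)
2[6+3p]+3≡3n = solve-∀

2[5+3p]+5≡3n : ∀ p → 2 * (5 + 3 * p) + 5 ≡ 3 * (5 + 2 * p)
2[5+3p]+5≡3n = solve-∀

InFₚ : ℕ → ℕ → ℕ → ℕ → Set
InFₚ p x y z =
    (z ≡ 0 × x ≤ 6 + 3 * p × y ≤ 1 + p)
  ⊎ (z ≡ 0 × x ≤ 1 × y ≡ 2 + p)
  ⊎ (z ≡ 1 × x ≤ 6 + 3 * p × y < p)
  ⊎ (z ≡ 1 × x ≤ 5 + 3 * p × y ≡ p)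

InFₚ⇒InF : ∀ p {x y z} → InFₚ p x y z → InF (5 + 2 * p) x y z
InFₚ⇒InF p (inj₁ (refl , x≤ , y≤)) =
  inj₁ (refl , double-≤ 3 x≤ (2[6+3p]+3≡3n p) , double-≤ 3 y≤ (2[1+p]+3≡n p))
InFₚ⇒InF p (inj₂ (inj₁ (refl , x≤1 , refl))) = inj₂ (inj₁ (refl , x≤1 , 2[2+p]+1≡n p))
InFₚ⇒InF p {y = y} (inj₂ (inj₂ (inj₁ (refl , x≤ , y<p)))) =
  inj₂ (inj₂ (inj₁ (refl , double-≤ 3 x≤ (2[6+3p]+3≡3n p) ,
                   ≤-trans (≤-reflexive (l y)) (double-≤ 5 y<p (+-comm (2 * p) 5)))))
  where
  l : ∀ y → 2 * y + 7 ≡ 2 * suc y + 5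
  l = solve-∀
InFₚ⇒InF p (inj₂ (inj₂ (inj₂ (refl , x≤ , refl)))) =
  inj₂ (inj₂ (inj₂ (refl , double-≤ 5 x≤ (2[5+3p]+5≡3n p) , +-comm (2 * p) 5)))

InF⇒InFₚ : ∀ p {x y z} → InF (5 + 2 * p) x y z → InFₚ p x y z
InF⇒InFₚ p (inj₁ (refl , 2x+3≤ , 2y+3≤)) =
  inj₁ (refl , undouble-≤ 3 2x+3≤ (2[6+3p]+3≡3n p) , undouble-≤ 3 2y+3≤ (2[1+p]+3≡n p))
InF⇒InFₚ p (inj₂ (inj₁ (refl , x≤1 , 2y+1≡))) = inj₂ (inj₁ (refl , x≤1 , undouble-≡ 1 2y+1≡ (2[2+p]+1≡n p)))
InF⇒InFₚ p {y = y} (inj₂ (inj₂ (inj₁ (refl , 2x+3≤ , 2y+7≤)))) =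
  inj₂ (inj₂ (inj₁ (refl , undouble-≤ 3 2x+3≤ (2[6+3p]+3≡3n p) ,
                   undouble-≤ 5 (≤-trans (≤-reflexive (l y)) 2y+7≤) (+-comm (2 * p) 5))))
  where
  l : ∀ y → 2 * suc y + 5 ≡ 2 * y + 7
  l = solve-∀
InF⇒InFₚ p (inj₂ (inj₂ (inj₂ (refl , 2x+5≤ , 2y+5≡)))) =
  inj₂ (inj₂ (inj₂ (refl , undouble-≤ 5 2x+5≤ (2[5+3p]+5≡3n p) , undouble-≡ 5 2y+5≡ (+-comm (2 * p) 5))))

InFₚ⇒¬DiffInS : ∀ p {x y z} → InFₚ p x y z → ¬ DiffInS (5 + 2 * p) (frob p) (val (5 + 2 * p) x y z)
InFₚ⇒¬DiffInS p {y = y} (inj₁ (refl , x≤ , y≤)) =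
  ¬DiffInS-below p z≤n (≤-trans (≤-reflexive (l y)) (double-≤ 3 y≤ (2[1+p]+3≡n p))) x≤ λ { (_ , () , _) }
  where
  l : ∀ y → suc (2 * (1 + y) + 0) ≡ 2 * y + 3
  l = solve-∀
InFₚ⇒¬DiffInS p (inj₂ (inj₁ (refl , x≤1 , refl))) = ¬DiffInS-top p x≤1
InFₚ⇒¬DiffInS p {y = y} (inj₂ (inj₂ (inj₁ (refl , x≤ , y<p)))) =
  ¬DiffInS-below p (s≤s z≤n) t<n x≤ (λ (y≡p , _) → <-irrefl y≡p y<p)
  where
  l₁ : ∀ y → suc (2 * (1 + y) + 1) ≡ 2 * suc y + 2
  l₁ = solve-∀
  l₂ : ∀ p → 3 + (2 * p + 2) ≡ 5 + 2 * p
  l₂ = solve-∀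
  t<n : 2 * (1 + y) + 1 < 5 + 2 * p
  t<n = ≤-trans (≤-reflexive (l₁ y)) (≤-trans (double-≤ 2 y<p refl) (≤-trans (m≤n+m _ 3) (≤-reflexive (l₂ p))))
InFₚ⇒¬DiffInS p (inj₂ (inj₂ (inj₂ (refl , x≤ , refl)))) =
  ¬DiffInS-below p (s≤s z≤n) (Residue.t<n (frob-residue p)) (m≤n⇒m≤1+n x≤)
    λ (_ , _ , x≡) → 1+n≰n (subst (_≤ 5 + 3 * p) x≡ x≤)

InFₚ-or-DiffInS-even : ∀ p x y → x ≤ 6 + 3 * p → 2 * y + 0 < 5 + 2 * p →
  InFₚ p x y 0 ⊎ DiffInS (5 + 2 * p) (frob p) (val (5 + 2 * p) x y 0)
InFₚ-or-DiffInS-even p x y x≤ t<n with y ≤? 1 + p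
... | yes y≤ = inj₁ (inj₁ (refl , x≤ , y≤))
... | no y≰ with ≤-antisym (subst (_≤ 2 + p) (+-identityʳ y) (residue-bound p z≤n t<n)) (≰⇒> y≰)
...   | refl with x ≤? 1
...     | yes x≤1 = inj₁ (inj₂ (inj₁ (refl , x≤1 , refl)))
...     | no x≰1 with m≤n⇒∃[o]m+o≡n (≰⇒> x≰1)
...       | e , refl = inj₂ (DiffInS-residue-n∸1 p e)

InFₚ-or-DiffInS-odd : ∀ p x y → x ≤ 6 + 3 * p → 2 * y + 1 < 5 + 2 * p →
  InFₚ p x y 1 ⊎ DiffInS (5 + 2 * p) (frob p) (val (5 + 2 * p) x y 1)
InFₚ-or-DiffInS-odd p x y x≤ t<n with <-cmp y p
... | tri< y<p _ _ = inj₁ (inj₂ (inj₂ (inj₁ (refl , x≤ , y<p))))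
... | tri≈ _ refl _ with x ≤? 5 + 3 * p
...   | yes x≤′ = inj₁ (inj₂ (inj₂ (inj₂ (refl , x≤′ , refl))))
...   | no x≰ with ≤-antisym x≤ (≰⇒> x≰)
...     | refl = inj₂ (DiffInS-2f p)
InFₚ-or-DiffInS-odd p x y x≤ t<n | tri> _ _ p<y
  with ≤-antisym (≤-pred (subst (_≤ 2 + p) (+-comm y 1) (residue-bound p (s≤s z≤n) t<n))) p<y
... | refl = inj₂ (DiffInS-residue-n∸2 p x)

InFₚ-or-DiffInS : ∀ p x y z → z ≤ 1 → 2 * y + z < 5 + 2 * p →
  InFₚ p x y z ⊎ DiffInS (5 + 2 * p) (frob p) (val (5 + 2 * p) x y z)
InFₚ-or-DiffInS p x y z z≤1 t<n with x ≤? 6 + 3 * p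
... | no x≰ with m≤n⇒∃[o]m+o≡n (≰⇒> x≰)
...   | e , refl = inj₂ (DiffInS-large-x p e y z)
InFₚ-or-DiffInS p x y z z≤n t<n       | yes x≤ = InFₚ-or-DiffInS-even p x y x≤ t<n
InFₚ-or-DiffInS p x y z (s≤s z≤n) t<n | yes x≤ = InFₚ-or-DiffInS-odd p x y x≤ t<n

InF⇒canonical : ∀ {n x y z} → InF n x y z → z ≤ 1 × 2 * y + z < n
InF⇒canonical {y = y} (inj₁ (refl , _ , 2y+3≤n)) = z≤n , +-<-≤ (2 * y) (s≤s z≤n) 2y+3≤n
InF⇒canonical {y = y} (inj₂ (inj₁ (refl , _ , 2y+1≡n))) = z≤n , +-<-≤ (2 * y) (s≤s z≤n) (≤-reflexive 2y+1≡n)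
InF⇒canonical {y = y} (inj₂ (inj₂ (inj₁ (refl , _ , 2y+7≤n)))) = s≤s z≤n , +-<-≤ (2 * y) (s≤s (s≤s z≤n)) 2y+7≤n
InF⇒canonical {y = y} (inj₂ (inj₂ (inj₂ (refl , _ , 2y+5≡n)))) =
  s≤s z≤n , +-<-≤ (2 * y) (s≤s (s≤s z≤n)) (≤-reflexive 2y+5≡n)

InF⇒2x+3≤3n : ∀ {n x y z} → 2 ≤ n → InF n x y z → 2 * x + 3 ≤ 3 * n
InF⇒2x+3≤3n _ (inj₁ (_ , 2x+3≤ , _)) = 2x+3≤
InF⇒2x+3≤3n 2≤n (inj₂ (inj₁ (_ , x≤1 , _))) =
  ≤-trans (+-monoˡ-≤ 3 (*-monoʳ-≤ 2 x≤1)) (≤-trans (n≤1+n 5) (*-monoʳ-≤ 3 2≤n))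
InF⇒2x+3≤3n _ (inj₂ (inj₂ (inj₁ (_ , 2x+3≤ , _)))) = 2x+3≤
InF⇒2x+3≤3n {x = x} _ (inj₂ (inj₂ (inj₂ (_ , 2x+5≤ , _)))) = ≤-trans (+-monoʳ-≤ (2 * x) (m≤n+m 3 2)) 2x+5≤

IsNF-intro : ∀ {n s} x y z → val n x y z ≡ s → z ≤ 1 → 2 * y + z < n → 2 * x + 3 ≤ 3 * n → IsNF n s x y z
IsNF-intro {n} x y z v≡s z≤1 t<n 2x+3≤3n =
  v≡s , s≤s z≤1 , ≤-trans (s≤s (m≤m+n (2 * y) z)) (≤-trans t<n (m≤m+n n 1)) ,
  ≤-trans (≤-reflexive (sym (+-suc (2 * x) 1))) (≤-trans (+-monoʳ-≤ (2 * x) (n≤1+n 2)) 2x+3≤3n)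

Ap⇒F : ∀ p s → InAp (5 + 2 * p) (frob p) s →
       ∃[ x ] ∃[ y ] ∃[ z ] (IsNF (5 + 2 * p) s x y z × InF (5 + 2 * p) x y z)
Ap⇒F p s (inj₂ refl , s-f∉S) = ⊥-elim (s-f∉S (0 , refl , inj₁ (0 , 0 , 0 , refl)))
Ap⇒F p s (inj₁ s∈T , s-f∉S) with residue-exists {5 + 2 * p} s
... | y , z , m , r@(residue z≤1 t<n e) with m≤n⇒∃[o]m+o≡n (InT⇒3[y+z]≤m (s≤s (s≤s z≤n)) r s∈T)
...   | x , refl with InFₚ-or-DiffInS p x y z z≤1 t<n
...     | inj₂ s-f∈S = ⊥-elim (s-f∉S (subst (DiffInS (5 + 2 * p) (frob p)) (residue⇒val x y z e) s-f∈S))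
...     | inj₁ x∈Fₚ =
  x , y , z , IsNF-intro x y z (residue⇒val x y z e) z≤1 t<n (InF⇒2x+3≤3n {y = y} {z} (s≤s (s≤s z≤n)) x∈F) , x∈F
  where
  x∈F : InF (5 + 2 * p) x y z
  x∈F = InFₚ⇒InF p x∈Fₚ

F⇒Ap : ∀ p x y z → InF (5 + 2 * p) x y z →
       ∃[ s ] (InAp (5 + 2 * p) (frob p) s × IsNF (5 + 2 * p) s x y z)
F⇒Ap p x y z x∈F =
  let (z≤1 , t<n) = InF⇒canonical {x = x} {y} {z} x∈F in
  val (5 + 2 * p) x y z , (inj₁ (x , y , z , refl) , InFₚ⇒¬DiffInS p (InF⇒InFₚ p {x} {y} {z} x∈F)) ,
  IsNF-intro x y z refl z≤1 t<n (InF⇒2x+3≤3n {y = y} {z} (s≤s (s≤s z≤n)) x∈F)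

mainTheorem4 : (n : ℕ) → 5 ≤ n → ¬ (2 ∣ n) → (f : ℕ) → IsFrobeniusT n f →
    ((s : ℕ) → InAp n f s → ∃[ x ] ∃[ y ] ∃[ z ] (IsNF n s x y z × InF n x y z))
    × ((x y z : ℕ) → InF n x y z → ∃[ s ] (InAp n f s × IsNF n s x y z))
    × ((s s′ x y z : ℕ) → InAp n f s → InAp n f s′ → IsNF n s x y z → IsNF n s′ x y z → s ≡ s′)
mainTheorem4 n 5≤n n-odd f f-frob with odd-form n 5≤n n-odd
... | p , refl with frobenius≡frob p f f-frob
...   | refl = Ap⇒F p , F⇒Ap p , λ _ _ _ _ _ _ _ nf nf′ → trans (sym (proj₁ nf)) (proj₁ nf′)
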